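{- Let $(L,G)$ be a generator enriched lattice. Any minor of $(L,G)$ may be expressed as the result of a contraction followed by a deletion. Namely, if $(K,H)$ is a minor of $(L,G)$ then $(K,H)=((L,G)/\widehat{0}_K)|_{H}$.
   Context: A generator enriched lattice is a pair $(L,G)$ with $L$ a finite lattice and $G\subseteq L\setminus\{\widehat0\}$ generating $L$ under joins. For $H\subseteq L$ and $z\in L$ with $z<h$ for all $h\in H$, $\langle H|z\rangle$ denotes $(\{z\}\cup\{\bigvee_{x\in S}x:\emptyset\ne S\subseteq H\},H)$. For $I\subseteq G$: the deletion is $(L,G)\setminus I=\langle G\setminus I|\widehat0_L\rangle$; with $i_0=\bigvee_{i\in I}i$ and $J=\{g\vee i_0:g\in G\}\setminus\{i_0\}$, the contraction is $(L,G)/I=\langle J|i_0\rangle$; the restriction is $(L,G)|_I=(L,G)\setminus(G\setminus I)$. For $\ell\in L$, $(L,G)\setminus\ell$ and $(L,G)/\ell$ denote deletion and contraction by $\{g\in G:g\le\ell\}$. A minor of $(L,G)$ is the result of any finite sequence of deletions and contractions (each by a subset of the current generating set) applied to $(L,G)$. -}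

module Defs where

open import Data.Nat using (ℕ)
open import Data.Fin using (Fin; _≟_)
open import Data.Fin.Properties using (any?)
open import Data.Fin.Subset using (Subset; _∈_; _∉_; _⊆_; _─_)
open import Data.Fin.Subset.Properties using (_∈?_)
open import Data.Vec using (tabulate)
open import Data.Bool using (Bool; _∧_; not)
open import Data.List.NonEmpty using (List⁺; foldr₁; toList)
open import Data.List.Relation.Unary.All using (All)
open import Data.Product using (Σ; _×_; _,_; ∃)
open import Data.Sum using (_⊎_)
open import Relation.Nullary.Decidable using (⌊_⌋; _×-dec_)
open import Relation.Binary using (Rel)
open import Relation.Binary.PropositionalEquality using (_≡_)
open import Relation.Binary.Lattice.Structures using (IsBoundedLattice)
open import Level using (0ℓ)

record FinLattice (n : ℕ) : Set₁ where
  field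
    _≤_ : Rel (Fin n) 0ℓ
    _∨_ : Fin n → Fin n → Fin n
    _⊓_ : Fin n → Fin n → Fin n
    top : Fin n
    bot : Fin n
    isBoundedLattice : IsBoundedLattice _≡_ _≤_ _∨_ _⊓_ top bot

module _ {n : ℕ} (L : FinLattice n) where
  open FinLattice L

  ⋁⁺ : List⁺ (Fin n) → Fin n
  ⋁⁺ = foldr₁ _∨_

  -- G generates L under joins (the empty join being 0̂_L)
  Generates : Subset n → Set
  Generates G = ∀ x → x ≡ bot ⊎ Σ (List⁺ (Fin n)) λ S → All (_∈ G) (toList S) × x ≡ ⋁⁺ S

  IsGEL : Subset n → Set
  IsGEL G = (bot ∉ G) × Generates G

  -- A pair ⟨H|z⟩ of the context, living inside the ambient lattice L:
  -- z is its bottom and H its generating set.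
  record GEL : Set where
    constructor ⟨_∣_⟩
    field
      gens : Subset n
      zerô : Fin n
  open GEL public

  Elem : GEL → Fin n → Set
  Elem E x = x ≡ zerô E ⊎ Σ (List⁺ (Fin n)) λ S → All (_∈ gens E) (toList S) × x ≡ ⋁⁺ S

  IsJoinIn : (Fin n → Set) → (Fin n → Set) → Fin n → Set
  IsJoinIn K I x = K x × (∀ i → I i → i ≤ x) × (∀ u → K u → (∀ i → I i → i ≤ u) → x ≤ u)

  whole : Subset n → GEL
  whole G = ⟨ G ∣ bot ⟩

  delete : GEL → Subset n → GEL
  delete E I = ⟨ gens E ─ I ∣ zerô E ⟩

  -- contraction, given i₀ = ⋁_{i ∈ I} i (joined in the current lattice):
  -- ⟨ J | i₀ ⟩ with J = {g ∨ i₀ : g ∈ H} ∖ {i₀}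
  contractGens : Subset n → Fin n → Subset n
  contractGens H i₀ = tabulate λ x →
    ⌊ any? (λ g → (g ∈? H) ×-dec ((g ∨ i₀) ≟ x)) ⌋ ∧ not ⌊ x ≟ i₀ ⌋

  contract : GEL → Fin n → GEL
  contract E i₀ = ⟨ contractGens (gens E) i₀ ∣ i₀ ⟩

  restrict : GEL → Subset n → GEL
  restrict E I = delete E (gens E ─ I)

  data Minor (G : Subset n) : GEL → Set where
    base : Minor G (whole G)
    del  : ∀ {E} → Minor G E → (I : Subset n) → I ⊆ gens E → Minor G (delete E I)
    con  : ∀ {E} → Minor G E → (I : Subset n) → I ⊆ gens E →
           (i₀ : Fin n) → IsJoinIn (Elem E) (_∈ I) i₀ → Minor G (contract E i₀)

-- Every minor ⟨H|z⟩ of (L,G) keeps two traces of the way it was built: its bottom z is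
-- the join of the elements of G below it, and each of its generators is g ∨ z for some
-- g ∈ G, distinct from z.  Both properties hold for (L,G) and survive deletion and
-- contraction; the second survives contraction by i₀ because z ≤ i₀ gives
-- (g ∨ z) ∨ i₀ = g ∨ i₀.  The first identifies z with the join i₀ of {g ∈ G : g ≤ z},
-- and then the second places H inside the generators g ∨ i₀ ≠ i₀ of (L,G)/i₀, so that
-- restricting (L,G)/i₀ to H gives back ⟨H|z⟩.
module Submission where

open import Defs
open import Data.Nat using (ℕ)
open import Data.Fin using (Fin)
open import Data.Fin.Subset using (Subset; _∈_; _⊆_)
open import Data.Product using (_×_)
open import Data.Unit using (⊤)
open import Relation.Binary.PropositionalEquality using (_≡_)

open import Level using (0ℓ)
open import Data.Bool using (Bool; true; _∧_; not)
open import Data.Fin using (_≟_)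
open import Data.Fin.Properties using (any?)
open import Data.Fin.Subset using (_─_; inside; outside)
open import Data.Fin.Subset.Properties using (_∈?_; drop-∷-⊆; p─q⊆p)
open import Data.Vec using ([]; _∷_; here; tabulate)
open import Data.Vec.Properties using (lookup⇒[]=; []=⇒lookup; lookup∘tabulate)
open import Data.List using ([]; _∷_)
open import Data.List.NonEmpty using (_∷_; toList)
open import Data.List.Relation.Unary.All as All using (All; []; _∷_)
open import Data.Product using (∃-syntax; _,_; proj₂)
open import Data.Sum using (inj₁; inj₂)
open import Relation.Nullary using (¬_; Dec; yes; no; contradiction)
open import Relation.Nullary.Decidable using (⌊_⌋; _×-dec_)
open import Relation.Binary.PropositionalEquality
  using (refl; sym; trans; cong; cong₂; subst; module ≡-Reasoning)
open import Relation.Binary.Lattice.Bundles using (BoundedLattice)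
import Relation.Binary.Lattice.Properties.JoinSemilattice as JoinSemilatticeProperties
import Relation.Binary.Lattice.Properties.BoundedJoinSemilattice as BoundedJoinSemilatticeProperties

q⊆p⇒p─[p─q]≡q : ∀ {m} (p q : Subset m) → q ⊆ p → p ─ (p ─ q) ≡ q
q⊆p⇒p─[p─q]≡q []            []            _   = refl
q⊆p⇒p─[p─q]≡q (inside  ∷ p) (inside  ∷ q) q⊆p = cong (inside ∷_)  (q⊆p⇒p─[p─q]≡q p q (drop-∷-⊆ q⊆p))
q⊆p⇒p─[p─q]≡q (inside  ∷ p) (outside ∷ q) q⊆p = cong (outside ∷_) (q⊆p⇒p─[p─q]≡q p q (drop-∷-⊆ q⊆p))
q⊆p⇒p─[p─q]≡q (outside ∷ p) (outside ∷ q) q⊆p = cong (outside ∷_) (q⊆p⇒p─[p─q]≡q p q (drop-∷-⊆ q⊆p))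
q⊆p⇒p─[p─q]≡q (outside ∷ p) (inside  ∷ q) q⊆p = contradiction (q⊆p here) λ ()

∈-tabulate⁺ : ∀ {m} (f : Fin m → Bool) {x} → f x ≡ true → x ∈ tabulate f
∈-tabulate⁺ f {x} fx≡true = lookup⇒[]= x (tabulate f) (trans (lookup∘tabulate f x) fx≡true)

∈-tabulate⁻ : ∀ {m} (f : Fin m → Bool) {x} → x ∈ tabulate f → f x ≡ true
∈-tabulate⁻ f {x} x∈f = trans (sym (lookup∘tabulate f x)) ([]=⇒lookup x∈f)

⌊a⌋∧not⌊b⌋≡true⇒a×¬b : ∀ {A B : Set} (a? : Dec A) (b? : Dec B) →
                       ⌊ a? ⌋ ∧ not ⌊ b? ⌋ ≡ true → A × ¬ B
⌊a⌋∧not⌊b⌋≡true⇒a×¬b (yes a) (no ¬b) _ = a , ¬b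
⌊a⌋∧not⌊b⌋≡true⇒a×¬b (yes a) (yes b) ()
⌊a⌋∧not⌊b⌋≡true⇒a×¬b (no ¬a) _       ()

a×¬b⇒⌊a⌋∧not⌊b⌋≡true : ∀ {A B : Set} (a? : Dec A) (b? : Dec B) →
                       A → ¬ B → ⌊ a? ⌋ ∧ not ⌊ b? ⌋ ≡ true
a×¬b⇒⌊a⌋∧not⌊b⌋≡true (yes _) (no _)  _ _  = refl
a×¬b⇒⌊a⌋∧not⌊b⌋≡true (yes _) (yes b) _ ¬b = contradiction b ¬b
a×¬b⇒⌊a⌋∧not⌊b⌋≡true (no ¬a) _       a _  = contradiction a ¬a

module _ {n : ℕ} (L : FinLattice n) where
  open FinLattice L

  boundedLattice : BoundedLattice 0ℓ 0ℓ 0ℓ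
  boundedLattice = record { isBoundedLattice = isBoundedLattice }

  open BoundedLattice boundedLattice
    using ( joinSemilattice; boundedJoinSemilattice
          ; antisym; minimum; x≤x∨y; y≤x∨y; ∨-least)
    renaming (refl to ≤-refl; trans to ≤-trans)
  open JoinSemilatticeProperties joinSemilattice using (∨-assoc; x≤y⇒x∨y≈y)
  open BoundedJoinSemilatticeProperties boundedJoinSemilattice using (identityʳ)

  ⋁⁺-preserves : (P : Fin n → Set) → (∀ {a b} → P a → P b → P (a ∨ b)) →
                 ∀ S → All P (toList S) → P (⋁⁺ L S)
  ⋁⁺-preserves P P-∨ (x ∷ [])     (px ∷ [])  = px
  ⋁⁺-preserves P P-∨ (x ∷ y ∷ ys) (px ∷ pys) = P-∨ px (⋁⁺-preserves P P-∨ (y ∷ ys) pys)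

  ∨-absorbsˡ : ∀ g {z i} → z ≤ i → (g ∨ z) ∨ i ≡ g ∨ i
  ∨-absorbsˡ g {z} {i} z≤i = begin
    (g ∨ z) ∨ i  ≡⟨ ∨-assoc g z i ⟩
    g ∨ (z ∨ i)  ≡⟨ cong (g ∨_) (x≤y⇒x∨y≈y z≤i) ⟩
    g ∨ i        ∎
    where open ≡-Reasoning

  ∈-contractGens⁻ : ∀ H i {h} → h ∈ contractGens L H i →
                    (∃[ g ] g ∈ H × g ∨ i ≡ h) × ¬ h ≡ i
  ∈-contractGens⁻ H i {h} h∈ =
    ⌊a⌋∧not⌊b⌋≡true⇒a×¬b (any? λ g → (g ∈? H) ×-dec ((g ∨ i) ≟ h)) (h ≟ i)
      (∈-tabulate⁻ _ h∈)

  ∈-contractGens⁺ : ∀ H i {h g} → g ∈ H → g ∨ i ≡ h → ¬ h ≡ i → h ∈ contractGens L H i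
  ∈-contractGens⁺ H i {h} {g} g∈H g∨i≡h h≢i = ∈-tabulate⁺ _
    (a×¬b⇒⌊a⌋∧not⌊b⌋≡true (any? λ g → (g ∈? H) ×-dec ((g ∨ i) ≟ h)) (h ≟ i)
      (g , g∈H , g∨i≡h) h≢i)

  module _ (G : Subset n) where

    Spanned : Fin n → Set
    Spanned x = ∀ u → (∀ g → g ∈ G → g ≤ x → g ≤ u) → x ≤ u

    Spanned-∨ : ∀ {x y} → Spanned x → Spanned y → Spanned (x ∨ y)
    Spanned-∨ {x} {y} sx sy u bounds = ∨-least
      (sx u λ g g∈G g≤x → bounds g g∈G (≤-trans g≤x (x≤x∨y x y)))
      (sy u λ g g∈G g≤y → bounds g g∈G (≤-trans g≤y (y≤x∨y x y)))

    Spanned-gen : ∀ {g} → g ∈ G → Spanned g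
    Spanned-gen {g} g∈G u bounds = bounds g g∈G ≤-refl

    Spanned⇒≡join : ∀ {x i} → Spanned x →
                    IsJoinIn L (λ _ → ⊤) (λ g → g ∈ G × g ≤ x) i → x ≡ i
    Spanned⇒≡join {x} sx (_ , upper , least) = antisym
      (sx _ λ g g∈G g≤x → upper g (g∈G , g≤x))
      (least x _ λ g → proj₂)

    record MinorShape (E : GEL L) : Set where
      field
        spanned-zerô : Spanned (zerô E)
        gens-lift    : ∀ {h} → h ∈ gens E → ∃[ g ] g ∈ G × h ≡ g ∨ zerô E
        gens-≢-zerô  : ∀ {h} → h ∈ gens E → ¬ h ≡ zerô E

      zerô≤gen : ∀ {h} → h ∈ gens E → zerô E ≤ h
      zerô≤gen h∈E with gens-lift h∈E
      ... | g , _ , refl = y≤x∨y g (zerô E)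

      spanned-gen : ∀ {h} → h ∈ gens E → Spanned h
      spanned-gen h∈E with gens-lift h∈E
      ... | g , g∈G , refl = Spanned-∨ (Spanned-gen g∈G) spanned-zerô

      zerô≤elem : ∀ {x} → Elem L E x → zerô E ≤ x
      zerô≤elem (inj₁ refl)           = ≤-refl
      zerô≤elem (inj₂ (S , S⊆E , refl)) =
        ⋁⁺-preserves (zerô E ≤_) (λ {a} {b} z≤a _ → ≤-trans z≤a (x≤x∨y a b)) S
          (All.map zerô≤gen S⊆E)

      spanned-elem : ∀ {x} → Elem L E x → Spanned x
      spanned-elem (inj₁ refl)           = spanned-zerô
      spanned-elem (inj₂ (S , S⊆E , refl)) =
        ⋁⁺-preserves Spanned Spanned-∨ S (All.map spanned-gen S⊆E)

    open MinorShape

    MinorShape-whole : IsGEL L G → MinorShape (whole L G)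
    MinorShape-whole (bot∉G , _) = record
      { spanned-zerô = λ u _ → minimum u
      ; gens-lift    = λ {h} h∈G → h , h∈G , sym (identityʳ h)
      ; gens-≢-zerô  = λ h∈G h≡bot → bot∉G (subst (_∈ G) h≡bot h∈G)
      }

    MinorShape-delete : ∀ {E} → MinorShape E → ∀ I → MinorShape (delete L E I)
    MinorShape-delete {E} shape I = record
      { spanned-zerô = spanned-zerô shape
      ; gens-lift    = λ h∈ → gens-lift shape (p─q⊆p (gens E) I h∈)
      ; gens-≢-zerô  = λ h∈ → gens-≢-zerô shape (p─q⊆p (gens E) I h∈)
      }

    MinorShape-contract : ∀ {E I i₀} → MinorShape E → IsJoinIn L (Elem L E) (_∈ I) i₀ →
                          MinorShape (contract L E i₀)
    MinorShape-contract {E} {I} {i₀} shape (i₀∈E , _) = record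
      { spanned-zerô = spanned-elem shape i₀∈E
      ; gens-lift    = lift
      ; gens-≢-zerô  = λ h∈ → proj₂ (∈-contractGens⁻ (gens E) i₀ h∈)
      }
      where
      lift : ∀ {h} → h ∈ contractGens L (gens E) i₀ → ∃[ g ] g ∈ G × h ≡ g ∨ i₀
      lift h∈ with ∈-contractGens⁻ (gens E) i₀ h∈
      ... | (h′ , h′∈E , refl) , _ with gens-lift shape h′∈E
      ... | g , g∈G , refl = g , g∈G , ∨-absorbsˡ g (zerô≤elem shape i₀∈E)

    minorShape : IsGEL L G → ∀ {E} → Minor L G E → MinorShape E
    minorShape gel base                 = MinorShape-whole gel
    minorShape gel (del minor I _)      = MinorShape-delete (minorShape gel minor) I
    minorShape gel (con minor I _ _ i₀) = MinorShape-contract (minorShape gel minor) i₀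

    gens⊆contractGens : ∀ {E} → MinorShape E →
                        gens E ⊆ contractGens L G (zerô E)
    gens⊆contractGens shape h∈E with gens-lift shape h∈E
    ... | g , g∈G , h≡g∨z = ∈-contractGens⁺ G _ g∈G (sym h≡g∨z) (gens-≢-zerô shape h∈E)

mainTheorem7 : {n : ℕ} (L : FinLattice n) (G : Subset n) → IsGEL L G →
    (E : GEL L) → Minor L G E →
    (i₀ : Fin n) → IsJoinIn L (λ _ → ⊤) (λ g → g ∈ G × FinLattice._≤_ L g (zerô E)) i₀ →
    (gens E ⊆ gens (contract L (whole L G) i₀))
      × (E ≡ restrict L (contract L (whole L G) i₀) (gens E))
mainTheorem7 L G gel E minor i₀ i₀-join =
  E⊆J , cong₂ ⟨_∣_⟩ (sym (q⊆p⇒p─[p─q]≡q _ (gens E) E⊆J)) z≡i₀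
  where
  shape : MinorShape L G E
  shape = minorShape L G gel minor

  z≡i₀ : zerô E ≡ i₀
  z≡i₀ = Spanned⇒≡join L G (MinorShape.spanned-zerô shape) i₀-join

  E⊆J : gens E ⊆ contractGens L G i₀
  E⊆J = subst (λ z → gens E ⊆ contractGens L G z) z≡i₀ (gens⊆contractGens L G shape)
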